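{- Let $\circ\in\{\land,\lor\}$ and let $k, n \in \mathbb N$ with $n \geq k \geq 3$. Let $S$ be the leftist circuit over $\{\circ\}$ on inputs $x_0, \dotsc, x_{n-1}$ and let $K \subseteq \{x_0,\dots,x_{n-1}\}$ be triangular with $|K| = k$. Then $B := B(K, S)$ satisfies $|B| \leq 2 \log_2 k - 1$.
   Context: Circuits: a circuit over $\{\circ\}$ on inputs $x_0,\dots,x_{n-1}$ is a finite directed acyclic graph whose sources are the input vertices and whose other vertices are gates, each with exactly two predecessors. For a vertex $v$, $\mathrm{In}_v(S)$ is the set of input vertices from which there is a directed path to $v$ ($\mathrm{In}_v(S)=\{v\}$ for an input). The depth of a vertex is the maximum number of edges on a directed path from an input to it. Leftist circuit: the circuit $S$ on $x_0,\dots,x_{n-1}$ constructed as follows. Set $i=0$, $M=n$; while $M \ge 2$: let $k'$ be maximal with $2^{k'}\le M$, add a perfect binary tree of $\circ$-gates of depth $k'$ whose leaves, read from left to right, are $x_i,\dots,x_{i+2^{k'}-1}$, then set $i\leftarrow i+2^{k'}$, $M\leftarrow M-2^{k'}$. Each vertex $v$ has $\mathrm{In}_v(S)=\{x_j: j\in I_v\}$ for an index interval $I_v$; $v$ is left of $w$ if $I_v\cap I_w=\emptyset$ and $\max I_v<\min I_w$. Boundary vertices: for $K\subseteq\{x_0,\dots,x_{n-1}\}$, $B(K,S)=\{v : \mathrm{In}_v(S)\subseteq K \text{ and } \mathrm{In}_w(S)\not\subseteq K \text{ for every successor } w \text{ of } v\}$. The boundary tree sequence $T_0,\dots,T_{|B|-1}$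 of $K$ consists of the subcircuits formed by each boundary vertex $b$ together with all vertices having a directed path to $b$ (perfect binary trees), ordered from left to right; $\mathrm{depth}(T_j)$ is the depth of its root. $K$ is triangular if there is $J\in\{0,\dots,|B|-1\}$ such that the inputs of $T_0,\dots,T_J$ form a set of inputs with consecutive indices, the inputs of $T_{J+1},\dots,T_{|B|-1}$ form a set of inputs with consecutive indices, $\mathrm{depth}(T_j)<\mathrm{depth}(T_{j+1})$ for $0\le j<J-1$, and $\mathrm{depth}(T_j)>\mathrm{depth}(T_{j+1})$ for $J+1\le j<|B|-1$; the empty set is also triangular. -}

module Defs where

open import Data.Nat using (ℕ; zero; suc; _+_; _*_; _∸_; _^_; _≤_; _<_; _>_; _<?_)
open import Data.Nat.Divisibility using (_∣_)
open import Data.Nat.Logarithm using (⌊log₂_⌋)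
open import Data.Fin using (Fin; fromℕ<)
open import Data.Fin.Subset using (Subset; _∈_; Empty)
open import Data.Product using (Σ; ∃; _×_; _,_; proj₁; proj₂)
open import Data.Sum using (_⊎_)
open import Data.List using (List; []; _∷_; take; drop; length)
open import Data.List.Membership.Propositional renaming (_∈_ to _∈ₗ_)
open import Data.List.Relation.Unary.Any using (Any)
open import Data.List.Relation.Unary.AllPairs using (AllPairs)
open import Data.List.Relation.Unary.Linked using (Linked)
open import Relation.Nullary using (¬_; yes; no)
open import Relation.Binary.PropositionalEquality using (_≡_)
open import Function.Bundles using (_⇔_)

-- The gate operation ∘ ∈ {∧, ∨}.  The shape of the leftist circuit (and hence
-- everything in the theorem) does not depend on which one is chosen.
data Op : Set where
  ∧op ∨op : Op

-- The loop of the construction: with fuel, current index i and remaining M,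
-- produce the list of trees (i , k') : a perfect binary tree of depth k'
-- whose leaves are x_i, …, x_{i+2^k'-1}.  (Fuel n suffices, since M drops
-- by at least 2 in every iteration.)
blocksFrom : ℕ → ℕ → ℕ → List (ℕ × ℕ)
blocksFrom zero    i M = []
blocksFrom (suc f) i M with M <? 2
... | yes _ = []
... | no  _ = (i , ⌊log₂ M ⌋) ∷ blocksFrom f (i + 2 ^ ⌊log₂ M ⌋) (M ∸ 2 ^ ⌊log₂ M ⌋)

treeBlocks : ℕ → List (ℕ × ℕ)
treeBlocks n = blocksFrom n 0 n

-- A vertex is encoded as (d , s): the vertex whose input set In_v(S) is
-- {x_s, …, x_{s+2^d-1}}; d is its depth (d = 0: input vertex x_s).
Vertex : Set
Vertex = ℕ × ℕ

depth : Vertex → ℕ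
depth = proj₁

start : Vertex → ℕ
start = proj₂

-- (d , s) is a node of the perfect binary tree (t , k'): its leaves form
-- the aligned sub-block [s, s + 2^d) of [t, t + 2^k').
NodeOf : Vertex → ℕ × ℕ → Set
NodeOf (d , s) (t , k') = (d ≤ k') × (t ≤ s) × (s + 2 ^ d ≤ t + 2 ^ k') × (2 ^ d ∣ (s ∸ t))

IsVertex : ℕ → Vertex → Set
IsVertex n (d , s) = ((d ≡ 0) × (s < n)) ⊎ Any (NodeOf (d , s)) (treeBlocks n)

InI : Vertex → ℕ → Set
InI (d , s) i = (s ≤ i) × (i < s + 2 ^ d)

-- w is a successor of v in S: the gate w has v as one of its two
-- predecessors, i.e. w is the parent of v in its perfect binary tree.
IsSucc : ℕ → Vertex → Vertex → Set
IsSucc n (d , s) (d' , s') =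
  IsVertex n (d' , s') × (d' ≡ suc d) × (s' ≤ s) × (s + 2 ^ d ≤ s' + 2 ^ d')

InSubK : (n : ℕ) → Subset n → Vertex → Set
InSubK n K v = ∀ i → InI v i → Σ (i < n) λ p → fromℕ< p ∈ K

IsBoundary : (n : ℕ) → Subset n → Vertex → Set
IsBoundary n K v =
  IsVertex n v × InSubK n K v × (∀ w → IsSucc n v w → ¬ InSubK n K w)

LeftOf : Vertex → Vertex → Set
LeftOf (d , s) (d' , s') = s + 2 ^ d ≤ s'

-- T is the boundary tree sequence of K (each tree T_j represented by its
-- root, a boundary vertex): it lists exactly B(K,S), ordered left to right.
IsBoundarySeq : (n : ℕ) → Subset n → List Vertex → Set
IsBoundarySeq n K T = (∀ v → (v ∈ₗ T) ⇔ IsBoundary n K v) × AllPairs LeftOf T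

Consecutive : List Vertex → Set
Consecutive L = ∀ a b c → a ≤ b → b ≤ c →
  Any (λ v → InI v a) L → Any (λ v → InI v c) L → Any (λ v → InI v b) L

-- K (with boundary tree sequence T) is triangular.
-- T_0 … T_J = take (suc J) T ; T_{J+1} … = drop (suc J) T.
Triangular : (n : ℕ) → Subset n → List Vertex → Set
Triangular n K T =
  Empty K ⊎
  Σ ℕ λ J → (J < length T)
    × Consecutive (take (suc J) T)
    × Consecutive (drop (suc J) T)
    × Linked (λ u v → depth u < depth v) (take (suc J) T)
    × Linked (λ u v → depth u > depth v) (drop (suc J) T)

-- The boundary trees are pairwise disjoint and all their leaves lie in K, so
-- their sizes 2^depth add up to at most k.  A strictly increasing run of a
-- depths has size at least 1 + 2 + ⋯ + 2^(a-1) = 2^a − 1, and likewise a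
-- strictly decreasing run of b depths; hence 2^a + 2^b ≤ k + 2.  For powers
-- of two this forces 2^(a+b+1) = 2·2^a·2^b ≤ k², i.e. |B| = a + b ≤ 2 log₂ k − 1.
module Submission where

open import Defs
open import Data.Nat using (ℕ; zero; suc; _+_; _*_; _^_; _∸_; _≤_; _<_; _>_; z≤n; s≤s; z<s)
open import Data.Nat.Properties
open import Data.Nat.Tactic.RingSolver using (solve-∀)
open import Data.Fin using (fromℕ<)
open import Data.Fin.Subset using (Subset; ∣_∣; inside; outside; _∈_)
open import Data.Fin.Subset.Properties using (Empty-unique; ∣⊥∣≡0)
open import Data.Vec using ([]; _∷_; here; there)
open import Data.Nat.ListAction using (sum)
open import Data.Nat.ListAction.Properties using (sum-++)
open import Data.List using (List; []; _∷_; _++_; map; length; take; drop)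
open import Data.List.Properties using (map-++; length-++; length-map; take++drop≡id)
open import Data.List.Relation.Unary.All as All using (All; []; _∷_)
open import Data.List.Relation.Unary.AllPairs using (AllPairs; []; _∷_)
open import Data.List.Relation.Unary.Linked as Linked using (Linked; _∷_)
open import Data.List.Relation.Unary.Linked.Properties using (map⁺)
open import Data.Product using (Σ; ∃-syntax; _,_; proj₁; proj₂)
open import Data.Sum using (inj₁; inj₂)
open import Function.Base using (_∘_)
open import Function.Bundles using (Equivalence)
open import Relation.Nullary using (contradiction)
open import Relation.Binary.PropositionalEquality
  using (_≡_; refl; sym; trans; cong; subst; module ≡-Reasoning)

countIn : ∀ {n} → Subset n → ℕ → ℕ → ℕ
countIn []            _       _       = 0
countIn (_ ∷ K)       (suc a) m       = countIn K a m
countIn (_ ∷ _)       zero    zero    = 0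
countIn (inside ∷ K)  zero    (suc m) = suc (countIn K zero m)
countIn (outside ∷ K) zero    (suc m) = countIn K zero m

countIn-≤-∣∣ : ∀ {n} (K : Subset n) m → countIn K 0 m ≤ ∣ K ∣
countIn-≤-∣∣ []            m       = z≤n
countIn-≤-∣∣ (_ ∷ K)       zero    = z≤n
countIn-≤-∣∣ (inside ∷ K)  (suc m) = s≤s (countIn-≤-∣∣ K m)
countIn-≤-∣∣ (outside ∷ K) (suc m) = countIn-≤-∣∣ K m

countIn-+ : ∀ {n} (K : Subset n) a m m' →
            countIn K a (m + m') ≡ countIn K a m + countIn K (a + m) m'
countIn-+ []            a       m       m' = refl
countIn-+ (_ ∷ K)       (suc a) m       m' = countIn-+ K a m m'
countIn-+ (_ ∷ K)       zero    zero    m' = refl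
countIn-+ (inside ∷ K)  zero    (suc m) m' = cong suc (countIn-+ K zero m m')
countIn-+ (outside ∷ K) zero    (suc m) m' = countIn-+ K zero m m'

IntervalIn : ∀ {n} → Subset n → ℕ → ℕ → Set
IntervalIn {n} K a m = ∀ i → a ≤ i → i < a + m → Σ (i < n) λ p → fromℕ< p ∈ K

countIn-interval : ∀ {n} (K : Subset n) a m → IntervalIn K a m → countIn K a m ≡ m
countIn-interval []      a       zero    _  = refl
countIn-interval []      a       (suc m) ⊆K = contradiction (proj₁ (⊆K a ≤-refl (m<m+n a z<s))) λ ()
countIn-interval (_ ∷ K) (suc a) m       ⊆K = countIn-interval K a m ⊆K′
  where
  ⊆K′ : IntervalIn K a m
  ⊆K′ i a≤i i<a+m with ⊆K (suc i) (s≤s a≤i) (s≤s i<a+m)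
  ... | s≤s p , there i∈K = p , i∈K
countIn-interval (_ ∷ K) zero    zero    _  = refl
countIn-interval (_ ∷ K) zero    (suc m) ⊆K with ⊆K 0 z≤n (s≤s z≤n)
... | s≤s z≤n , here = cong suc (countIn-interval K zero m ⊆K′)
  where
  ⊆K′ : IntervalIn K zero m
  ⊆K′ i _ i<m with ⊆K (suc i) z≤n (s≤s i<m)
  ... | s≤s p , there i∈K = p , i∈K

countIn-window-≤ : ∀ {n} (K : Subset n) {a s} m → a ≤ s →
                   countIn K s m ≤ countIn K a ((s ∸ a) + m)
countIn-window-≤ K {a} {s} m a≤s = begin
  countIn K s m                                  ≤⟨ m≤n+m _ _ ⟩
  countIn K a (s ∸ a) + countIn K s m            ≡⟨ cong (λ b → countIn K a (s ∸ a) + countIn K b m)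
                                                         (sym (m+[n∸m]≡n a≤s)) ⟩
  countIn K a (s ∸ a) + countIn K (a + (s ∸ a)) m ≡⟨ sym (countIn-+ K a (s ∸ a) m) ⟩
  countIn K a ((s ∸ a) + m)                      ∎
  where open ≤-Reasoning

weight : List ℕ → ℕ
weight ds = sum (map (2 ^_) ds)

leaves : List Vertex → ℕ
leaves T = weight (map depth T)

leaves-++ : ∀ A D → leaves (A ++ D) ≡ leaves A + leaves D
leaves-++ A D = begin
  sum (map (2 ^_) (map depth (A ++ D)))                      ≡⟨ cong (sum ∘ map (2 ^_)) (map-++ depth A D) ⟩
  sum (map (2 ^_) (map depth A ++ map depth D))               ≡⟨ cong sum (map-++ (2 ^_) (map depth A) _) ⟩
  sum (map (2 ^_) (map depth A) ++ map (2 ^_) (map depth D)) ≡⟨ sum-++ (map (2 ^_) (map depth A)) _ ⟩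
  leaves A + leaves D                                         ∎
  where open ≡-Reasoning

leaves-≤-countIn : ∀ {n} (K : Subset n) {T} a → AllPairs LeftOf T → All (InSubK n K) T →
                   All (λ v → a ≤ start v) T → ∃[ m ] leaves T ≤ countIn K a m
leaves-≤-countIn K a [] [] [] = 0 , z≤n
leaves-≤-countIn K {(d , s) ∷ T} a (rightOfV ∷ disjoint) (v⊆K ∷ T⊆K) (a≤s ∷ _)
  with leaves-≤-countIn K (s + 2 ^ d) disjoint T⊆K rightOfV
... | m , leavesT≤ = (s ∸ a) + (2 ^ d + m) , (begin
  2 ^ d + leaves T                              ≤⟨ +-monoʳ-≤ (2 ^ d) leavesT≤ ⟩
  2 ^ d + countIn K (s + 2 ^ d) m               ≡⟨ cong (_+ countIn K (s + 2 ^ d) m) (sym vFull) ⟩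
  countIn K s (2 ^ d) + countIn K (s + 2 ^ d) m ≡⟨ sym (countIn-+ K s (2 ^ d) m) ⟩
  countIn K s (2 ^ d + m)                       ≤⟨ countIn-window-≤ K (2 ^ d + m) a≤s ⟩
  countIn K a ((s ∸ a) + (2 ^ d + m))           ∎)
  where
  open ≤-Reasoning
  vFull : countIn K s (2 ^ d) ≡ 2 ^ d
  vFull = countIn-interval K s (2 ^ d) λ i s≤i i<s+2^d → v⊆K i (s≤i , i<s+2^d)

leaves-≤-∣∣ : ∀ {n} (K : Subset n) {T} → AllPairs LeftOf T → All (InSubK n K) T → leaves T ≤ ∣ K ∣
leaves-≤-∣∣ K disjoint T⊆K with leaves-≤-countIn K 0 disjoint T⊆K (All.tabulate λ _ → z≤n)
... | m , leavesT≤ = ≤-trans leavesT≤ (countIn-≤-∣∣ K m)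

2^suc≡2^+2^ : ∀ m → 2 ^ suc m ≡ 2 ^ m + 2 ^ m
2^suc≡2^+2^ m = cong (2 ^ m +_) (+-identityʳ (2 ^ m))

weight-increasing-from : ∀ {m d} ds → m ≤ d → Linked _<_ (d ∷ ds) →
                         2 ^ (m + length (d ∷ ds)) ≤ weight (d ∷ ds) + 2 ^ m
weight-increasing-from {m} {d} [] m≤d _ = begin
  2 ^ (m + 1)     ≡⟨ cong (2 ^_) (+-comm m 1) ⟩
  2 ^ suc m       ≡⟨ 2^suc≡2^+2^ m ⟩
  2 ^ m + 2 ^ m   ≤⟨ +-monoˡ-≤ (2 ^ m) (^-monoʳ-≤ 2 m≤d) ⟩
  2 ^ d + 2 ^ m   ≡⟨ cong (λ x → x + 2 ^ m) (sym (+-identityʳ (2 ^ d))) ⟩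
  2 ^ d + 0 + 2 ^ m ∎
  where open ≤-Reasoning
weight-increasing-from {m} {d} (e ∷ es) m≤d (d<e ∷ increasing) = begin
  2 ^ (m + suc (length (e ∷ es)))           ≡⟨ cong (2 ^_) (+-suc m _) ⟩
  2 ^ (suc m + length (e ∷ es))             ≤⟨ weight-increasing-from es (≤-trans (s≤s m≤d) d<e) increasing ⟩
  weight (e ∷ es) + 2 ^ suc m               ≡⟨ cong (weight (e ∷ es) +_) (2^suc≡2^+2^ m) ⟩
  weight (e ∷ es) + (2 ^ m + 2 ^ m)         ≤⟨ +-monoʳ-≤ (weight (e ∷ es)) (+-monoˡ-≤ (2 ^ m) (^-monoʳ-≤ 2 m≤d)) ⟩
  weight (e ∷ es) + (2 ^ d + 2 ^ m)         ≡⟨ sym (+-assoc (weight (e ∷ es)) _ _) ⟩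
  weight (e ∷ es) + 2 ^ d + 2 ^ m           ≡⟨ cong (_+ 2 ^ m) (+-comm (weight (e ∷ es)) (2 ^ d)) ⟩
  weight (d ∷ e ∷ es) + 2 ^ m               ∎
  where open ≤-Reasoning

weight-increasing : ∀ ds → Linked _<_ ds → 2 ^ length ds ≤ weight ds + 1
weight-increasing []       _          = ≤-refl
weight-increasing (d ∷ ds) increasing = weight-increasing-from ds z≤n increasing

length-≤-head-decreasing : ∀ {d} ds → Linked _>_ (d ∷ ds) → length ds ≤ d
length-≤-head-decreasing []       _                   = z≤n
length-≤-head-decreasing (e ∷ es) (d>e ∷ decreasing) =
  ≤-trans (s≤s (length-≤-head-decreasing es decreasing)) d>e

weight-decreasing : ∀ ds → Linked _>_ ds → 2 ^ length ds ≤ weight ds + 1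
weight-decreasing []       _          = ≤-refl
weight-decreasing (d ∷ ds) decreasing = begin
  2 ^ suc (length ds)            ≡⟨ 2^suc≡2^+2^ (length ds) ⟩
  2 ^ length ds + 2 ^ length ds  ≤⟨ +-mono-≤ (^-monoʳ-≤ 2 (length-≤-head-decreasing ds decreasing))
                                             (weight-decreasing ds (Linked.tail decreasing)) ⟩
  2 ^ d + (weight ds + 1)        ≡⟨ sym (+-assoc (2 ^ d) _ 1) ⟩
  weight (d ∷ ds) + 1            ∎
  where open ≤-Reasoning

-- (x + y − 2)² − 2xy = (x − 2)² + (y − 2)² − 4, which is ≥ 0 once x ≥ 4.
double-product-≤-square : ∀ {x y k} → 4 ≤ x → x + y ≤ k + 2 → 2 * x * y ≤ k * k
double-product-≤-square {suc (suc (suc (suc u)))} {y} {k} (s≤s (s≤s (s≤s (s≤s _)))) x+y≤k+2 =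
  ≤-trans (bound y) (*-mono-≤ x+y∸2≤k x+y∸2≤k)
  where
  x+y∸2≤k : 2 + u + y ≤ k
  x+y∸2≤k = +-cancelʳ-≤ 2 _ k (subst (_≤ k + 2) (shift u y) x+y≤k+2)
    where
    shift : ∀ u y → 4 + u + y ≡ 2 + u + y + 2
    shift = solve-∀
  bound : ∀ y → 2 * (4 + u) * y ≤ (2 + u + y) * (2 + u + y)
  bound zero = ≤-trans (≤-reflexive (*-zeroʳ (2 * (4 + u)))) z≤n
  bound (suc zero) = subst (2 * (4 + u) * 1 ≤_) (sym (square u)) (m≤m+n _ _)
    where
    square : ∀ u → (2 + u + 1) * (2 + u + 1) ≡ 2 * (4 + u) * 1 + (1 + 4 * u + u * u)
    square = solve-∀
  bound (suc (suc t)) = subst (2 * (4 + u) * (2 + t) ≤_) (sym (square u t)) (m≤m+n _ _)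
    where
    square : ∀ u t → (2 + u + (2 + t)) * (2 + u + (2 + t)) ≡ 2 * (4 + u) * (2 + t) + (u * u + t * t + 4 * u)
    square = solve-∀

2^[a+b+1]≡2*2^a*2^b : ∀ a b → 2 ^ (a + b + 1) ≡ 2 * 2 ^ a * 2 ^ b
2^[a+b+1]≡2*2^a*2^b a b = begin
  2 ^ (a + b + 1)     ≡⟨ ^-distribˡ-+-* 2 (a + b) 1 ⟩
  2 ^ (a + b) * 2     ≡⟨ cong (_* 2) (^-distribˡ-+-* 2 a b) ⟩
  2 ^ a * 2 ^ b * 2   ≡⟨ rotate (2 ^ a) (2 ^ b) ⟩
  2 * 2 ^ a * 2 ^ b   ∎
  where
  open ≡-Reasoning
  rotate : ∀ x y → x * y * 2 ≡ 2 * x * y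
  rotate = solve-∀

power-sum-bound-large : ∀ a b {k} → 4 ≤ 2 ^ a → 2 ^ a + 2 ^ b ≤ k + 2 → 2 ^ (a + b + 1) ≤ k * k
power-sum-bound-large a b 4≤2^a sum≤ =
  subst (_≤ _) (sym (2^[a+b+1]≡2*2^a*2^b a b)) (double-product-≤-square 4≤2^a sum≤)

power-sum-bound-small : ∀ {a b k} → a ≤ 1 → b ≤ 1 → 3 ≤ k → 2 ^ (a + b + 1) ≤ k * k
power-sum-bound-small a≤1 b≤1 3≤k =
  ≤-trans (^-monoʳ-≤ 2 (+-monoˡ-≤ 1 (+-mono-≤ a≤1 b≤1)))
          (≤-trans (n≤1+n 8) (*-mono-≤ 3≤k 3≤k))

power-sum-bound : ∀ a b {k} → 3 ≤ k → 2 ^ a + 2 ^ b ≤ k + 2 → 2 ^ (a + b + 1) ≤ k * k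
power-sum-bound (suc (suc a)) b _ sum≤ =
  power-sum-bound-large (2 + a) b (^-monoʳ-≤ 2 {2} {2 + a} (s≤s (s≤s z≤n))) sum≤
power-sum-bound a (suc (suc b)) {k} _ sum≤ =
  subst (λ e → 2 ^ (e + 1) ≤ k * k) (+-comm (2 + b) a)
    (power-sum-bound-large (2 + b) a (^-monoʳ-≤ 2 {2} {2 + b} (s≤s (s≤s z≤n)))
      (subst (_≤ k + 2) (+-comm (2 ^ a) _) sum≤))
power-sum-bound 0 0 3≤k _ = power-sum-bound-small z≤n z≤n 3≤k
power-sum-bound 0 1 3≤k _ = power-sum-bound-small z≤n ≤-refl 3≤k
power-sum-bound 1 0 3≤k _ = power-sum-bound-small ≤-refl z≤n 3≤k
power-sum-bound 1 1 3≤k _ = power-sum-bound-small ≤-refl ≤-refl 3≤k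

IncreasingDepths DecreasingDepths : List Vertex → Set
IncreasingDepths = Linked (λ u v → depth u < depth v)
DecreasingDepths = Linked (λ u v → depth u > depth v)

unimodal-length-bound : ∀ {k} A D → 3 ≤ k → IncreasingDepths A → DecreasingDepths D →
                        leaves (A ++ D) ≤ k → 2 ^ (length (A ++ D) + 1) ≤ k * k
unimodal-length-bound {k} A D 3≤k increasing decreasing leaves≤k =
  subst (λ ℓ → 2 ^ (ℓ + 1) ≤ k * k) (sym (length-++ A))
    (power-sum-bound (length A) (length D) 3≤k (begin
      2 ^ length A + 2 ^ length D        ≤⟨ +-mono-≤ runA runD ⟩
      (leaves A + 1) + (leaves D + 1)    ≡⟨ regroup (leaves A) (leaves D) ⟩
      (leaves A + leaves D) + 2          ≡⟨ cong (_+ 2) (sym (leaves-++ A D)) ⟩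
      leaves (A ++ D) + 2                ≤⟨ +-monoˡ-≤ 2 leaves≤k ⟩
      k + 2                              ∎))
  where
  open ≤-Reasoning
  runA : 2 ^ length A ≤ leaves A + 1
  runA = subst (λ ℓ → 2 ^ ℓ ≤ leaves A + 1) (length-map depth A)
           (weight-increasing (map depth A) (map⁺ increasing))
  runD : 2 ^ length D ≤ leaves D + 1
  runD = subst (λ ℓ → 2 ^ ℓ ≤ leaves D + 1) (length-map depth D)
           (weight-decreasing (map depth D) (map⁺ decreasing))
  regroup : ∀ x y → x + 1 + (y + 1) ≡ x + y + 2
  regroup = solve-∀

mainTheorem7 : (∘ : Op) (k n : ℕ) → 3 ≤ k → k ≤ n →
    (K : Subset n) → ∣ K ∣ ≡ k →
    (T : List Vertex) → IsBoundarySeq n K T → Triangular n K T →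
    2 ^ (length T + 1) ≤ k * k
mainTheorem7 _ k n 3≤k _ K refl T _ (inj₁ K-empty) = contradiction (subst (3 ≤_) ∣K∣≡0 3≤k) λ ()
  where
  ∣K∣≡0 : ∣ K ∣ ≡ 0
  ∣K∣≡0 = trans (cong ∣_∣ (Empty-unique K-empty)) (∣⊥∣≡0 n)
mainTheorem7 _ k n 3≤k _ K refl T (boundary , disjoint) (inj₂ (J , _ , _ , _ , increasing , decreasing)) =
  subst (λ L → 2 ^ (length L + 1) ≤ k * k) (take++drop≡id (suc J) T)
    (unimodal-length-bound (take (suc J) T) (drop (suc J) T) 3≤k increasing decreasing
      (subst (λ L → leaves L ≤ k) (sym (take++drop≡id (suc J) T)) (leaves-≤-∣∣ K disjoint T⊆K)))
  where
  T⊆K : All (InSubK n K) T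
  T⊆K = All.tabulate λ v∈T → proj₁ (proj₂ (Equivalence.to (boundary _) v∈T))
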